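{- Let $G$ be a tree rooted at an arbitrary vertex, and for $v\in V(G)$ let $c_v$ denote the number of children of $v$ in $G$. Let $H$ be a graph with $V(H)\supseteq V(G)$ and maximum degree $\Delta\ge 3$, and let $v\in V(G)$ be a vertex with $c_v\ge 1$. Define $\operatorname{cost}_H(v)=\sum_{w:\,p(w)=v}\operatorname{dist}_H(v,w)$, the sum over the children $w$ of $v$ in $G$. Then \[ \operatorname{cost}_H(v)\ \ge\ c_v h_v+\frac{\Delta h_v}{\Delta-2}-\frac{\Delta\big((\Delta-1)^{h_v}-1\big)}{(\Delta-2)^2}, \] where $h_v=1+\big\lfloor \log_{\Delta-1}\lceil c_v/\Delta\rceil\big\rfloor$. Moreover, if $c_v\ge \Delta(\Delta-1)$, then \[ \operatorname{cost}_H(v)\ \ge\ c_v\left(\frac{\log c_v}{\log(\Delta-1)}-4\right). \]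
   Context: $p$ denotes the parent function of the rooted tree $G$; $\operatorname{dist}_H$ is the shortest-path distance in $H$. Logarithms without a base are base $2$. -}

module Defs where

open import Data.Nat using (ℕ; zero; suc; _+_; _*_; _∸_; _^_; _≤_; _<_; _<ᵇ_)
open import Data.Nat.DivMod using (_/_)
open import Data.Nat.GeneralisedArithmetic using (iterate)
open import Data.Bool using (Bool; true; false; if_then_else_)
open import Data.Fin using (Fin)
open import Data.Fin.Properties using (_≟_)
open import Data.List using (List; filter; length; sum; map; allFin)
open import Data.Product using (∃; _×_)
open import Relation.Binary.PropositionalEquality using (_≡_; _≢_)
open import Relation.Nullary using (¬_; Dec; yes; no)
open import Relation.Nullary.Decidable using (_×-dec_; ¬?)
open import Data.Bool.Properties using () renaming (_≟_ to _≟ᵇ_)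

-- Rooted trees on vertex set Fin m, given by a parent function p.
-- The root r satisfies p r ≡ r (convention), every vertex reaches the
-- root by iterating p.  The edges are {x , p x} for x ≢ r.

record RootedTree (m : ℕ) : Set where
  field
    root    : Fin m
    parent  : Fin m → Fin m
    parent-root : parent root ≡ root
    reaches-root : ∀ x → ∃ λ k → iterate parent x k ≡ root

open RootedTree public

IsChild : ∀ {m} (G : RootedTree m) → Fin m → Fin m → Set
IsChild G v w = ¬ (w ≡ root G) × parent G w ≡ v

isChild? : ∀ {m} (G : RootedTree m) (v w : Fin m) → Dec (IsChild G v w)
isChild? G v w = ¬? (w ≟ root G) ×-dec (parent G w ≟ v)

children : ∀ {m} (G : RootedTree m) → Fin m → List (Fin m)
children {m} G v = filter (isChild? G v) (allFin m)

numChildren : ∀ {m} (G : RootedTree m) → Fin m → ℕ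
numChildren G v = length (children G v)

record Graph (n : ℕ) : Set where
  field
    adj     : Fin n → Fin n → Bool
    adj-sym : ∀ x y → adj x y ≡ adj y x
    adj-irr : ∀ x → adj x x ≡ false

open Graph public

degree : ∀ {n} (H : Graph n) → Fin n → ℕ
degree {n} H u = length (filter (λ x → adj H u x ≟ᵇ true) (allFin n))

MaxDegree : ∀ {n} (H : Graph n) → ℕ → Set
MaxDegree H Δ = (∀ u → degree H u ≤ Δ) × (∃ λ u → degree H u ≡ Δ)

data Walk {n : ℕ} (H : Graph n) : Fin n → Fin n → ℕ → Set where
  nil  : ∀ {u} → Walk H u u 0
  cons : ∀ {u x w k} → adj H u x ≡ true → Walk H x w k → Walk H u w (suc k)

IsDist : ∀ {n} (H : Graph n) → Fin n → Fin n → ℕ → Set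
IsDist H u w d = Walk H u w d × (∀ k → Walk H u w k → d ≤ k)

-- ⌈ a / b ⌉ (with ⌈ a / 0 ⌉ = 0 as a junk value, never used)
ceilDiv : ℕ → ℕ → ℕ
ceilDiv a zero    = 0
ceilDiv a (suc b) = (a + b) / suc b

flogAux : ℕ → ℕ → ℕ → ℕ
flogAux zero       b             a = 0
flogAux (suc fuel) zero          a = 0
flogAux (suc fuel) (suc zero)    a = 0
flogAux (suc fuel) (suc (suc b)) a =
  if a <ᵇ suc (suc b) then 0 else suc (flogAux fuel (suc (suc b)) (a / suc (suc b)))

floorLog : ℕ → ℕ → ℕ
floorLog b a = flogAux a b a

hval : ℕ → ℕ → ℕ
hval Δ c = suc (floorLog (Δ ∸ 1) (ceilDiv c Δ))

module Submission where

-- Let u = ι v and b = Δ - 1. A vertex at distance k + 1 ≥ 2 from u has a neighbour at distance k,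
-- so it has at most b neighbours at distance k + 2; hence the sphere of radius k + 1 around u has
-- at most Δ b^k vertices and the punctured ball of radius k at most M k = Δ (b^k - 1) / (b - 1)
-- (the Moore bound). The children of v are sent injectively into H at distance ≥ 1 from u, so at
-- most M k of them lie within distance k. The layer-cake identity
--   Σ_w min(d w, h) + Σ_{k<h} #{w : d w ≤ k} = h c_v
-- then gives h c_v ≤ cost + Σ_{k<h} M k for every h, and Σ_{k<h} M k is computed in closed form.
-- For the logarithmic bound take h = ⌊log_b c_v⌋, where Σ_{k<h} M k ≤ Δ b^h / (b - 1)² ≤ 3 c_v;
-- this only needs c_v ≥ 1.

open import Defs
open import Data.Bool using (true)
open import Data.Bool.Properties using () renaming (_≟_ to _≟ᵇ_)
open import Data.Empty using (⊥-elim)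
open import Data.Fin using (Fin; toℕ; fromℕ<)
open import Data.Fin.Properties using (_≟_; any?; all?; toℕ<n; toℕ-fromℕ<)
open import Data.Integer using (+_; _⊖_) renaming (_≤_ to _≤ℤ_; _+_ to _+ℤ_; _-_ to _-ℤ_)
open import Data.Integer.Properties as ℤ using ([+m]-[+n]≡m⊖n; ⊖-monoˡ-≤; ⊖-≥)
open import Data.List using (List; []; _∷_; _++_; length; filter; map; concatMap; allFin)
open import Data.List.Membership.Propositional using (_∈_)
open import Data.List.Membership.Propositional.Properties
  using (∈-∃++; ∈-++⁻; ∈-++⁺ˡ; ∈-++⁺ʳ; ∈-concat⁺′; ∈-map⁺; ∈-map⁻; ∈-filter⁺; ∈-filter⁻; ∈-allFin)
open import Data.List.Properties using (length-++; length-map; length-filter; filter-notAll; filter-accept; filter-reject)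
open import Data.List.Relation.Binary.Subset.Propositional using (_⊆_)
open import Data.List.Relation.Unary.All as All using ()
open import Data.List.Relation.Unary.Any as Any using (Any; here; there)
open import Data.List.Relation.Unary.AllPairs using (_∷_)
open import Data.List.Relation.Unary.Unique.Propositional using (Unique)
open import Data.List.Relation.Unary.Unique.Propositional.Properties using (filter⁺; allFin⁺; map⁺)
open import Data.Nat using (ℕ; zero; suc; _+_; _*_; _∸_; _^_; _≤_; _<_; _<?_; _≤?_; _⊓_; z≤n; s≤s; s≤s⁻¹)
open import Data.Nat.GeneralisedArithmetic using (iterate)
open import Data.Nat.ListAction using (sum)
open import Data.Nat.Properties hiding (_≟_)
open import Data.Nat.Tactic.RingSolver using (solve-∀)
open import Algebra.Properties.CommutativeSemigroup *-commutativeSemigroup using (x∙yz≈y∙xz; xy∙z≈y∙xz)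
open import Data.Product using (∃; _×_; _,_; proj₂)
open import Data.Sum using (inj₁; inj₂)
open import Function using (Injective)
open import Relation.Binary.PropositionalEquality
open import Relation.Nullary using (¬_; Dec; yes; no)
open import Relation.Nullary.Decidable using (_×-dec_; ¬?; map′)

module _ {A : Set} where

  length-≤-⊆ : {xs ys : List A} → Unique xs → xs ⊆ ys → length xs ≤ length ys
  length-≤-⊆ {[]} _ _ = z≤n
  length-≤-⊆ {x ∷ xs} (x∉xs ∷ xs!) xs⊆ys with ∈-∃++ (xs⊆ys (here refl))
  ... | ys₁ , ys₂ , refl = begin
      suc (length xs)               ≤⟨ s≤s (length-≤-⊆ xs! xs⊆ys₁++ys₂) ⟩
      suc (length (ys₁ ++ ys₂))     ≡⟨ cong suc (length-++ ys₁) ⟩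
      suc (length ys₁ + length ys₂) ≡⟨ sym (+-suc (length ys₁) (length ys₂)) ⟩
      length ys₁ + suc (length ys₂) ≡⟨ sym (length-++ ys₁) ⟩
      length (ys₁ ++ x ∷ ys₂)       ∎
    where
    open ≤-Reasoning
    xs⊆ys₁++ys₂ : xs ⊆ ys₁ ++ ys₂
    xs⊆ys₁++ys₂ {y} y∈xs with ∈-++⁻ ys₁ (xs⊆ys (there y∈xs))
    ... | inj₁ y∈ys₁         = ∈-++⁺ˡ y∈ys₁
    ... | inj₂ (here refl)   = ⊥-elim (All.lookup x∉xs y∈xs refl)
    ... | inj₂ (there y∈ys₂) = ∈-++⁺ʳ ys₁ y∈ys₂

  length-concatMap-≤ : ∀ {B : Set} (f : A → List B) {c} xs →
    (∀ {x} → x ∈ xs → length (f x) ≤ c) → length (concatMap f xs) ≤ c * length xs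
  length-concatMap-≤ f []       _ = z≤n
  length-concatMap-≤ f {c} (x ∷ xs) bound = begin
    length (f x ++ concatMap f xs)         ≡⟨ length-++ (f x) ⟩
    length (f x) + length (concatMap f xs) ≤⟨ +-mono-≤ (bound (here refl)) (length-concatMap-≤ f xs (λ x∈ → bound (there x∈))) ⟩
    c + c * length xs                      ≡⟨ sym (*-suc c (length xs)) ⟩
    c * suc (length xs)                    ∎
    where open ≤-Reasoning

sumBelow : (ℕ → ℕ) → ℕ → ℕ
sumBelow f zero    = 0
sumBelow f (suc h) = sumBelow f h + f h

sumBelow-mono-≤ : ∀ {f g} → (∀ k → f k ≤ g k) → ∀ h → sumBelow f h ≤ sumBelow g h
sumBelow-mono-≤ f≤g zero    = z≤n
sumBelow-mono-≤ f≤g (suc h) = +-mono-≤ (sumBelow-mono-≤ f≤g h) (f≤g h)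

module LayerCake {A : Set} (d : A → ℕ) where

  atMost : ℕ → List A → List A
  atMost k = filter (λ x → d x ≤? k)

  truncatedSum : ℕ → List A → ℕ
  truncatedSum h xs = sum (map (λ x → d x ⊓ h) xs)

  truncatedSum-≤ : ∀ h xs → truncatedSum h xs ≤ sum (map d xs)
  truncatedSum-≤ h []       = z≤n
  truncatedSum-≤ h (x ∷ xs) = +-mono-≤ (m⊓n≤m (d x) h) (truncatedSum-≤ h xs)

  truncatedSum-suc : ∀ h xs → truncatedSum (suc h) xs + length (atMost h xs) ≡ truncatedSum h xs + length xs
  truncatedSum-suc h [] = refl
  truncatedSum-suc h (x ∷ xs) with d x ≤? h
  ... | yes dx≤h
    rewrite filter-accept (λ x → d x ≤? h) {xs = xs} dx≤h
          | m≤n⇒m⊓n≡m dx≤h | m≤n⇒m⊓n≡m (m≤n⇒m≤1+n dx≤h) =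
      trans (shuffle (d x) _ _) (trans (cong (λ s → suc (d x + s)) (truncatedSum-suc h xs)) (sym (shuffle (d x) _ _)))
    where
    shuffle : ∀ a s t → a + s + suc t ≡ suc (a + (s + t))
    shuffle = solve-∀
  ... | no dx≰h
    rewrite filter-reject (λ x → d x ≤? h) {xs = xs} dx≰h
          | m≥n⇒m⊓n≡n (≰⇒> dx≰h) | m≥n⇒m⊓n≡n (≰⇒≥ dx≰h) =
      trans (+-assoc (suc h) _ _) (trans (cong (_+_ (suc h)) (truncatedSum-suc h xs)) (shuffle h _ _))
    where
    shuffle : ∀ a s t → suc a + (s + t) ≡ a + s + suc t
    shuffle = solve-∀

  layerCake : ∀ h xs → truncatedSum h xs + sumBelow (λ k → length (atMost k xs)) h ≡ h * length xs
  layerCake zero    xs = trans (+-identityʳ (truncatedSum 0 xs)) (truncatedSum-zero xs)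
    where
    truncatedSum-zero : ∀ xs → truncatedSum 0 xs ≡ 0
    truncatedSum-zero []       = refl
    truncatedSum-zero (x ∷ xs) rewrite ⊓-zeroʳ (d x) = truncatedSum-zero xs
  layerCake (suc h) xs = begin
    truncatedSum (suc h) xs + (Σ + length (atMost h xs)) ≡⟨ shuffle (truncatedSum (suc h) xs) Σ _ ⟩
    truncatedSum (suc h) xs + length (atMost h xs) + Σ   ≡⟨ cong (_+ Σ) (truncatedSum-suc h xs) ⟩
    truncatedSum h xs + length xs + Σ                    ≡⟨ shuffle′ (truncatedSum h xs) (length xs) Σ ⟩
    length xs + (truncatedSum h xs + Σ)                  ≡⟨ cong (_+_ (length xs)) (layerCake h xs) ⟩
    length xs + h * length xs                            ∎
    where
    open ≡-Reasoning
    Σ = sumBelow (λ k → length (atMost k xs)) h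
    shuffle : ∀ a s t → a + (s + t) ≡ a + t + s
    shuffle = solve-∀
    shuffle′ : ∀ a s t → a + s + t ≡ s + (a + t)
    shuffle′ = solve-∀

  layerCake-≤ : ∀ {S : ℕ → ℕ} xs → (∀ k → length (atMost k xs) ≤ S k) →
    ∀ h → h * length xs ≤ sum (map d xs) + sumBelow S h
  layerCake-≤ xs bound h = begin
    h * length xs                                               ≡⟨ sym (layerCake h xs) ⟩
    truncatedSum h xs + sumBelow (λ k → length (atMost k xs)) h ≤⟨ +-mono-≤ (truncatedSum-≤ h xs) (sumBelow-mono-≤ bound h) ⟩
    sum (map d xs) + sumBelow _ h                               ∎
    where open ≤-Reasoning

module Distances {n} (H : Graph n) where

  neighbours : Fin n → List (Fin n)
  neighbours z = filter (λ x → adj H z x ≟ᵇ true) (allFin n)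

  walk? : ∀ k x y → Dec (Walk H x y k)
  walk? zero x y with x ≟ y
  ... | yes refl = yes nil
  ... | no x≢y   = no λ { nil → x≢y refl }
  walk? (suc k) x y with any? (λ z → (adj H x z ≟ᵇ true) ×-dec walk? k z y)
  ... | yes (z , xz , w) = yes (cons xz w)
  ... | no ∄z            = no λ { (cons xz w) → ∄z (_ , xz , w) }

  isDist? : ∀ x y d → Dec (IsDist H x y d)
  isDist? x y d = map′ fromShort toShort (walk? d x y ×-dec all? λ (j : Fin d) → ¬? (walk? (toℕ j) x y))
    where
    fromShort : Walk H x y d × (∀ (j : Fin d) → ¬ Walk H x y (toℕ j)) → IsDist H x y d
    fromShort (w , none) = w , λ k wₖ → ≮⇒≥ λ k<d →
      none (fromℕ< k<d) (subst (Walk H x y) (sym (toℕ-fromℕ< k<d)) wₖ)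
    toShort : IsDist H x y d → Walk H x y d × (∀ (j : Fin d) → ¬ Walk H x y (toℕ j))
    toShort (w , minimal) = w , λ j wⱼ → <⇒≱ (toℕ<n j) (minimal _ wⱼ)

  IsDist-unique : ∀ {x y d d′} → IsDist H x y d → IsDist H x y d′ → d ≡ d′
  IsDist-unique (w , min) (w′ , min′) = ≤-antisym (min _ w′) (min′ _ w)

  walk-snoc : ∀ {x y z k} → Walk H x y k → adj H y z ≡ true → Walk H x z (suc k)
  walk-snoc nil         yz = cons yz nil
  walk-snoc (cons xw w) yz = cons xw (walk-snoc w yz)

  walk-unsnoc : ∀ {x z k} → Walk H x z (suc k) → ∃ λ y → Walk H x y k × adj H y z ≡ true
  walk-unsnoc (cons xz nil) = _ , nil , xz
  walk-unsnoc (cons xw (cons wv w)) with walk-unsnoc (cons wv w)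
  ... | y , w′ , yz = y , cons xw w′ , yz

  IsDist-predecessor : ∀ {x z k} → IsDist H x z (suc k) → ∃ λ y → IsDist H x y k × adj H y z ≡ true
  IsDist-predecessor (w , minimal) with walk-unsnoc w
  ... | y , w′ , yz = y , (w′ , λ j wⱼ → s≤s⁻¹ (minimal (suc j) (walk-snoc wⱼ yz))) , yz

  IsDist-zero : ∀ {x y} → IsDist H x y 0 → x ≡ y
  IsDist-zero (nil , _) = refl

moore : ℕ → ℕ → ℕ
moore b zero    = 0
moore b (suc k) = suc b * b ^ k + moore b k

module Spheres {n} (H : Graph n) (u : Fin n) (b : ℕ) (degree≤ : ∀ z → degree H z ≤ suc b) where
  open Distances H

  sphere : ℕ → List (Fin n)
  sphere k = filter (λ y → isDist? u y k) (allFin n)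

  sphere-unique : ∀ k → Unique (sphere k)
  sphere-unique k = filter⁺ (λ y → isDist? u y k) (allFin⁺ n)

  ∈sphere⁻ : ∀ {k y} → y ∈ sphere k → IsDist H u y k
  ∈sphere⁻ {k} y∈ = proj₂ (∈-filter⁻ (λ y → isDist? u y k) {xs = allFin n} y∈)

  ∈sphere⁺ : ∀ {k y} → IsDist H u y k → y ∈ sphere k
  ∈sphere⁺ {k} {y} dist = ∈-filter⁺ (λ y → isDist? u y k) (∈-allFin y) dist

  ∈neighbours⁺ : ∀ {y z} → adj H z y ≡ true → y ∈ neighbours z
  ∈neighbours⁺ {y} zy = ∈-filter⁺ (λ x → adj H _ x ≟ᵇ true) (∈-allFin y) zy

  outward : ℕ → Fin n → List (Fin n)
  outward k z = filter (λ y → isDist? u y (suc k)) (neighbours z)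

  sphere-suc-⊆ : ∀ k → sphere (suc k) ⊆ concatMap (outward k) (sphere k)
  sphere-suc-⊆ k {y} y∈ with IsDist-predecessor (∈sphere⁻ y∈)
  ... | z , dist-z , zy =
    ∈-concat⁺′ (∈-filter⁺ (λ y → isDist? u y (suc k)) (∈neighbours⁺ zy) (∈sphere⁻ y∈)) (∈-map⁺ (outward k) (∈sphere⁺ dist-z))

  length-outward-≤ : ∀ k z → length (outward k z) ≤ suc b
  length-outward-≤ k z = ≤-trans (length-filter _ (neighbours z)) (degree≤ z)

  -- The neighbour of z on a shortest path back to u is at distance k, hence not outward.
  length-outward-suc-≤ : ∀ k {z} → z ∈ sphere (suc k) → length (outward (suc k) z) ≤ b
  length-outward-suc-≤ k {z} z∈ with IsDist-predecessor (∈sphere⁻ z∈)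
  ... | y , dist-y , yz = s≤s⁻¹ (≤-trans (filter-notAll _ (neighbours z) y-inward) (degree≤ z))
    where
    y-inward : Any (λ x → ¬ IsDist H u x (suc (suc k))) (neighbours z)
    y-inward = Any.map (λ { refl dist → <⇒≢ (m<n+m k {2} (s≤s z≤n)) (IsDist-unique dist-y dist) })
                       (∈neighbours⁺ (trans (adj-sym H z y) yz))

  length-sphere-zero : length (sphere 0) ≤ 1
  length-sphere-zero = length-≤-⊆ {ys = u ∷ []} (sphere-unique 0) λ y∈ → here (sym (IsDist-zero (∈sphere⁻ y∈)))

  length-sphere-suc : ∀ k → length (sphere (suc k)) ≤ suc b * b ^ k
  length-sphere-suc zero = begin
    length (sphere 1)                         ≤⟨ length-≤-⊆ (sphere-unique 1) (sphere-suc-⊆ 0) ⟩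
    length (concatMap (outward 0) (sphere 0)) ≤⟨ length-concatMap-≤ (outward 0) (sphere 0) (λ _ → length-outward-≤ 0 _) ⟩
    suc b * length (sphere 0)                 ≤⟨ *-monoʳ-≤ (suc b) length-sphere-zero ⟩
    suc b * 1                                 ∎
    where open ≤-Reasoning
  length-sphere-suc (suc k) = begin
    length (sphere (2 + k))                               ≤⟨ length-≤-⊆ (sphere-unique (2 + k)) (sphere-suc-⊆ (suc k)) ⟩
    length (concatMap (outward (suc k)) (sphere (suc k))) ≤⟨ length-concatMap-≤ (outward (suc k)) (sphere (suc k)) (length-outward-suc-≤ k) ⟩
    b * length (sphere (suc k))                           ≤⟨ *-monoʳ-≤ b (length-sphere-suc k) ⟩
    b * (suc b * b ^ k)                                   ≡⟨ x∙yz≈y∙xz b (suc b) (b ^ k) ⟩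
    suc b * (b * b ^ k)                                   ∎
    where open ≤-Reasoning

  punctured-ball : ℕ → List (Fin n)
  punctured-ball zero    = []
  punctured-ball (suc k) = sphere (suc k) ++ punctured-ball k

  length-punctured-ball : ∀ k → length (punctured-ball k) ≤ moore b k
  length-punctured-ball zero    = z≤n
  length-punctured-ball (suc k) =
    ≤-trans (≤-reflexive (length-++ (sphere (suc k))))
            (+-mono-≤ (length-sphere-suc k) (length-punctured-ball k))

  ∈punctured-ball⁺ : ∀ {j k y} → 1 ≤ j → j ≤ k → IsDist H u y j → y ∈ punctured-ball k
  ∈punctured-ball⁺ {suc j} {suc k} _ j≤k dist with m≤n⇒m<n∨m≡n j≤k
  ... | inj₂ refl = ∈-++⁺ˡ (∈sphere⁺ dist)
  ... | inj₁ j<k  = ∈-++⁺ʳ (sphere (suc k)) (∈punctured-ball⁺ (s≤s z≤n) (s≤s⁻¹ j<k) dist)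

m≤o+n⇒[+m]-[+n]≤+o : ∀ {m n o} → m ≤ o + n → + m -ℤ + n ≤ℤ + o
m≤o+n⇒[+m]-[+n]≤+o {m} {n} {o} m≤o+n = begin
  + m -ℤ + n    ≡⟨ [+m]-[+n]≡m⊖n m n ⟩
  m ⊖ n         ≤⟨ ⊖-monoˡ-≤ n m≤o+n ⟩
  (o + n) ⊖ n   ≡⟨ ⊖-≥ (m≤n+m n o) ⟩
  + (o + n ∸ n) ≡⟨ cong +_ (m+n∸n≡m o n) ⟩
  + o           ∎
  where open ℤ.≤-Reasoning

-- Parametrised by D = Δ - 2, so that b = Δ - 1 and Δ are successors and no truncated subtraction occurs.
module Arithmetic (D : ℕ) where

  b Δ : ℕ
  b = suc D
  Δ = suc b

  moore-closed : ∀ k → D * moore b k + Δ ≡ Δ * b ^ k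
  moore-closed zero = base D Δ
    where
    base : ∀ D Δ → D * 0 + Δ ≡ Δ * 1
    base = solve-∀
  moore-closed (suc k) = begin
    D * (Δ * b ^ k + moore b k) + Δ       ≡⟨ regroup D Δ (b ^ k) (moore b k) ⟩
    D * (Δ * b ^ k) + (D * moore b k + Δ) ≡⟨ cong (_+_ (D * (Δ * b ^ k))) (moore-closed k) ⟩
    D * (Δ * b ^ k) + Δ * b ^ k           ≡⟨ factor D Δ (b ^ k) ⟩
    Δ * (b * b ^ k)                       ∎
    where
    open ≡-Reasoning
    regroup : ∀ D Δ x m → D * (Δ * x + m) + Δ ≡ D * (Δ * x) + (D * m + Δ)
    regroup = solve-∀
    factor : ∀ D Δ x → D * (Δ * x) + Δ * x ≡ Δ * (suc D * x)
    factor = solve-∀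

  sumBelow-moore-closed : ∀ h → D * D * sumBelow (moore b) h + Δ * h * D + Δ ≡ Δ * b ^ h
  sumBelow-moore-closed zero = base D Δ
    where
    base : ∀ D Δ → D * D * 0 + Δ * 0 * D + Δ ≡ Δ * 1
    base = solve-∀
  sumBelow-moore-closed (suc h) = begin
    D * D * (Σ + moore b h) + Δ * suc h * D + Δ
      ≡⟨ regroup D Δ h (moore b h) Σ ⟩
    (D * D * Σ + Δ * h * D + Δ) + D * (D * moore b h + Δ)
      ≡⟨ cong₂ (λ x y → x + D * y) (sumBelow-moore-closed h) (moore-closed h) ⟩
    Δ * b ^ h + D * (Δ * b ^ h)
      ≡⟨ factor D Δ (b ^ h) ⟩
    Δ * (b * b ^ h) ∎
    where
    open ≡-Reasoning
    Σ = sumBelow (moore b) h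
    regroup : ∀ D Δ h m s → D * D * (s + m) + Δ * suc h * D + Δ ≡ (D * D * s + Δ * h * D + Δ) + D * (D * m + Δ)
    regroup = solve-∀
    factor : ∀ D Δ x → Δ * x + D * (Δ * x) ≡ Δ * (suc D * x)
    factor = solve-∀

  cost-bound : ∀ c h cost → h * c ≤ cost + sumBelow (moore b) h →
    (+ (c * h * (D ^ 2)) +ℤ + (Δ * h * D)) -ℤ + (Δ * (b ^ h ∸ 1)) ≤ℤ + (cost * (D ^ 2))
  cost-bound c h cost hc≤ = m≤o+n⇒[+m]-[+n]≤+o (begin
    c * h * D ^ 2 + Δ * h * D                      ≡⟨ cong (λ x → x * D ^ 2 + Δ * h * D) (*-comm c h) ⟩
    h * c * D ^ 2 + Δ * h * D                      ≤⟨ +-monoˡ-≤ (Δ * h * D) (*-monoˡ-≤ (D ^ 2) hc≤) ⟩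
    (cost + Σ) * D ^ 2 + Δ * h * D                 ≡⟨ regroup cost Σ D (Δ * h * D) ⟩
    cost * D ^ 2 + (D * D * Σ + Δ * h * D)         ≡⟨ cong (_+_ (cost * D ^ 2)) (sym (m+n∸n≡m _ Δ)) ⟩
    cost * D ^ 2 + (D * D * Σ + Δ * h * D + Δ ∸ Δ) ≡⟨ cong (λ x → cost * D ^ 2 + (x ∸ Δ)) (sumBelow-moore-closed h) ⟩
    cost * D ^ 2 + (Δ * b ^ h ∸ Δ)                 ≡⟨ cong (λ x → cost * D ^ 2 + (Δ * b ^ h ∸ x)) (sym (*-identityʳ Δ)) ⟩
    cost * D ^ 2 + (Δ * b ^ h ∸ Δ * 1)             ≡⟨ cong (_+_ (cost * D ^ 2)) (sym (*-distribˡ-∸ Δ (b ^ h) 1)) ⟩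
    cost * D ^ 2 + Δ * (b ^ h ∸ 1)                 ∎)
    where
    open ≤-Reasoning
    Σ = sumBelow (moore b) h
    regroup : ∀ a s D x → (a + s) * (D * (D * 1)) + x ≡ a * (D * (D * 1)) + (D * D * s + x)
    regroup = solve-∀

power-bracket : ∀ b → 1 < b → ∀ c → 1 ≤ c → ∃ λ g → b ^ g ≤ c × c < b ^ suc g
power-bracket b 1<b (suc zero) _ = 0 , ≤-refl , ≤-trans 1<b (≤-reflexive (sym (*-identityʳ b)))
power-bracket b@(suc _) 1<b (suc (suc c)) _ with power-bracket b 1<b (suc c) (s≤s z≤n)
... | g , bᵍ≤ , <bᵍ⁺¹ with 2 + c <? b ^ suc g
...   | yes <bᵍ⁺¹′ = g , m≤n⇒m≤1+n bᵍ≤ , <bᵍ⁺¹′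
...   | no  ≮bᵍ⁺¹ = suc g , ≤-reflexive bᵍ⁺¹≡ , (begin-strict
    2 + c         ≡⟨ sym bᵍ⁺¹≡ ⟩
    b ^ suc g     <⟨ m<m*n (b ^ suc g) b {{m^n≢0 b (suc g)}} 1<b ⟩
    b ^ suc g * b ≡⟨ *-comm (b ^ suc g) b ⟩
    b * b ^ suc g ∎)
  where
  open ≤-Reasoning
  bᵍ⁺¹≡ : b ^ suc g ≡ 2 + c
  bᵍ⁺¹≡ = ≤-antisym (≮⇒≥ ≮bᵍ⁺¹) <bᵍ⁺¹

module LogArithmetic (e : ℕ) where
  open Arithmetic (suc e)

  Δ≤3D² : Δ ≤ 3 * (suc e * suc e)
  Δ≤3D² = begin
    3 + e               ≤⟨ +-monoʳ-≤ 3 (m≤n*m e 3) ⟩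
    3 + 3 * e           ≡⟨ sym (*-suc 3 e) ⟩
    3 * suc e           ≤⟨ *-monoʳ-≤ 3 (m≤m*n (suc e) (suc e)) ⟩
    3 * (suc e * suc e) ∎
    where open ≤-Reasoning

  log-cost-bound : ∀ c cost → 1 ≤ c → (∀ h → h * c ≤ cost + sumBelow (moore b) h) → c ^ c ≤ b ^ (cost + 4 * c)
  log-cost-bound c cost 1≤c hc≤ with power-bracket b (s≤s (s≤s z≤n)) c 1≤c
  ... | g , bᵍ≤c , c<bᵍ⁺¹ = begin
    c ^ c              ≤⟨ ^-monoˡ-≤ c (<⇒≤ c<bᵍ⁺¹) ⟩
    (b ^ suc g) ^ c    ≡⟨ ^-*-assoc b (suc g) c ⟩
    b ^ (suc g * c)    ≤⟨ ^-monoʳ-≤ b (begin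
      c + g * c              ≤⟨ +-monoʳ-≤ c (hc≤ g) ⟩
      c + (cost + Σ)         ≤⟨ +-monoʳ-≤ c (+-monoʳ-≤ cost Σ≤3c) ⟩
      c + (cost + 3 * c)     ≡⟨ regroup c cost ⟩
      cost + 4 * c           ∎) ⟩
    b ^ (cost + 4 * c) ∎
    where
    open ≤-Reasoning
    Σ = sumBelow (moore b) g
    DD = suc e * suc e
    Σ≤3c : Σ ≤ 3 * c
    Σ≤3c = *-cancelˡ-≤ DD (begin
      DD * Σ                     ≤⟨ ≤-trans (m≤m+n _ (Δ * g * suc e)) (m≤m+n _ Δ) ⟩
      DD * Σ + Δ * g * suc e + Δ ≡⟨ sumBelow-moore-closed g ⟩
      Δ * b ^ g                  ≤⟨ *-mono-≤ Δ≤3D² bᵍ≤c ⟩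
      3 * DD * c                 ≡⟨ xy∙z≈y∙xz 3 DD c ⟩
      DD * (3 * c)               ∎)
    regroup : ∀ c cost → c + (cost + 3 * c) ≡ cost + 4 * c
    regroup = solve-∀

iterate-fixed : ∀ {A : Set} (f : A → A) {x} → f x ≡ x → ∀ k → iterate f x k ≡ x
iterate-fixed f fx≡x zero    = refl
iterate-fixed f fx≡x (suc k) rewrite fx≡x = iterate-fixed f fx≡x k

IsChild⇒≢ : ∀ {m} (G : RootedTree m) {v w} → IsChild G v w → w ≢ v
IsChild⇒≢ G {v} (w≢root , pv≡v) refl with reaches-root G v
... | k , iterate≡root = w≢root (trans (sym (iterate-fixed (parent G) pv≡v k)) iterate≡root)

length-atMost-children-≤ : ∀ {m n} (G : RootedTree m) (H : Graph n) (ι : Fin m → Fin n) →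
  Injective _≡_ _≡_ ι → (b : ℕ) → (∀ z → degree H z ≤ suc b) →
  ∀ v (d : Fin m → ℕ) → (∀ w → IsChild G v w → IsDist H (ι v) (ι w) (d w)) →
  ∀ k → length (LayerCake.atMost d k (children G v)) ≤ moore b k
length-atMost-children-≤ {m} G H ι ι-inj b degree≤ v d dist k = begin
  length near               ≡⟨ sym (length-map ι near) ⟩
  length (map ι near)       ≤⟨ length-≤-⊆ near-unique near⊆ball ⟩
  length (punctured-ball k) ≤⟨ length-punctured-ball k ⟩
  moore b k                 ∎
  where
  open ≤-Reasoning
  open Spheres H (ι v) b degree≤
  near = LayerCake.atMost d k (children G v)

  near-unique : Unique (map ι near)
  near-unique = map⁺ ι-inj (filter⁺ (λ w → d w ≤? k) (filter⁺ (isChild? G v) (allFin⁺ m)))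

  1≤d : ∀ {w} → IsChild G v w → 1 ≤ d w
  1≤d {w} child with d w | dist w child
  ... | zero  | dist₀ = ⊥-elim (IsChild⇒≢ G child (sym (ι-inj (Distances.IsDist-zero H dist₀))))
  ... | suc _ | _     = s≤s z≤n

  near⊆ball : map ι near ⊆ punctured-ball k
  near⊆ball y∈ with ∈-map⁻ ι y∈
  ... | w , w∈near , refl with ∈-filter⁻ (λ w → d w ≤? k) {xs = children G v} w∈near
  ... | w∈children , dw≤k =
    let child = proj₂ (∈-filter⁻ (isChild? G v) {xs = allFin m} w∈children)
    in ∈punctured-ball⁺ (1≤d child) dw≤k (dist w child)

lemma2 : ∀ {m n} (G : RootedTree m) (H : Graph n) (ι : Fin m → Fin n)
    → Injective _≡_ _≡_ ι
    → (Δ : ℕ) → 3 ≤ Δ → MaxDegree H Δ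
    → (v : Fin m) → 1 ≤ numChildren G v
    → (d : Fin m → ℕ)
    → (∀ w → IsChild G v w → IsDist H (ι v) (ι w) (d w))
    → let c    = numChildren G v
          cost = sum (map d (children G v))
          h    = hval Δ c
      in ((+ (c * h * ((Δ ∸ 2) ^ 2)) +ℤ + (Δ * h * (Δ ∸ 2)))
            -ℤ + (Δ * ((Δ ∸ 1) ^ h ∸ 1))
            ≤ℤ + (cost * ((Δ ∸ 2) ^ 2)))
       × (Δ * (Δ ∸ 1) ≤ c → c ^ c ≤ (Δ ∸ 1) ^ (cost + 4 * c))
lemma2 G H ι ι-inj (suc (suc (suc e))) (s≤s (s≤s (s≤s z≤n))) (degree≤Δ , _) v 1≤c d dist =
  cost-bound c h cost (hc≤ h) , λ _ → log-cost-bound c cost 1≤c hc≤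
  where
  open Arithmetic (suc e) using (b; Δ; cost-bound)
  open LogArithmetic e using (log-cost-bound)
  c = numChildren G v
  cost = sum (map d (children G v))
  h = hval Δ c
  hc≤ : ∀ k → k * c ≤ cost + sumBelow (moore b) k
  hc≤ = LayerCake.layerCake-≤ d (children G v)
          (length-atMost-children-≤ G H ι ι-inj b degree≤Δ v d dist)
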